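{- (Subject reduction) Let $\mathcal R$ be a polarized rewrite system such that $\longrightarrow_{ - }$ and $\longrightarrow_{+}$ commute. If $\pi$ is a proof-term of $\Gamma \vdash_{\mathcal R} A$ and $\pi \triangleright \pi'$, then $\pi'$ is a proof-term of $\Gamma \vdash_{\mathcal R} A$.
   Context: Propositions are built from atomic propositions (propositional symbols) and the constant $\bot$ using the binary connectives $\Rightarrow$, $\wedge$, $\vee$; $\neg A$ abbreviates $A \Rightarrow \bot$. A rewrite rule is a pair $P \longrightarrow A$ with $P$ an atomic proposition and $A$ an arbitrary proposition. A polarized rewrite system $\mathcal R = \langle \mathcal R_{ - }, \mathcal R_{+}\rangle$ is a pair of sets of rewrite rules; rules of $\mathcal R_{ - }$ are called negative, those of $\mathcal R_{+}$ positive. The one-step relations $\longrightarrow^1_{ - }$, $\longrightarrow^1_{+}$ are the least relations on propositions such that: $P \longrightarrow^1_{ - } A$ for every negative rule $P \longrightarrow A$; $P \longrightarrow^1_{+} A$ for every positive rule $P\longrightarrow A$; $A \Rightarrow B \longrightarrow^1_{ - } A' \Rightarrow B$ if $A \longrightarrow^1_{+} A'$, and $A \Rightarrow B \longrightarrow^1_{ - } A \Rightarrow B'$ if $B \longrightarrow^1_{ - } B'$; $A \Rightarrow B \longrightarrow^1_{+} A' \Rightarrow B$ if $A \longrightarrow^1_{ - } A'$, and $A \Rightarrow B \longrightarrow^1_{+} A \Rightarrow B'$ if $B \longrightarrow^1_{+} B'$; for $\circ \in \{\wedge, \vee\}$ and $s \in \{ -,+\}$, $A \circ B \longrightarrow^1_{s}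 A' \circ B$ if $A \longrightarrow^1_{s} A'$, and $A \circ B \longrightarrow^1_{s} A \circ B'$ if $B \longrightarrow^1_{s} B'$. The relations $\longrightarrow_{ - }$, $\longrightarrow_{+}$ are the reflexive-transitive closures of $\longrightarrow^1_{ - }$, $\longrightarrow^1_{+}$; $B \longleftarrow_{s} A$ means $A \longrightarrow_{s} B$. The relations $\longrightarrow_{ - }$ and $\longrightarrow_{+}$ commute if whenever $A \longleftarrow_{ - } B \longrightarrow_{+} C$ there is a proposition $D$ with $A \longrightarrow_{+} D \longleftarrow_{ - } C$. Proof-terms: $\pi ::= \alpha \mid \lambda\alpha\,\pi \mid (\pi_1\,\pi_2) \mid \langle \pi_1,\pi_2\rangle \mid \mathit{fst}(\pi) \mid \mathit{snd}(\pi) \mid i(\pi) \mid j(\pi) \mid \delta(\pi_1, \alpha\pi_2, \beta\pi_3) \mid \delta_\bot(\pi)$, with $\alpha,\beta$ proof variables ($\lambda\alpha$ binds $\alpha$; in $\delta(\pi_1,\alpha\pi_2,\beta\pi_3)$, $\alpha$ is bound in $\pi_2$ and $\beta$ in $\pi_3$). A context $\Gamma$ is a finite set of declarations $\alpha : B$ of distinct proof variables. "$\pi$ is a proof-term of $\Gamma \vdash_{\mathcal R} A$" (polarized natural deduction modulo $\mathcal R$) is defined inductively: (axiom) $\alpha$ is a proof-term of $\Gamma \vdash_{\mathcal R} A$ if $\alpha:B \in \Gamma$ and $B \longrightarrow_{ - } C \longleftarrow_{+} A$ for some $C$; ($\Rightarrow$-intro) if $\pi$ is a proof-term of $\Gamma,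 \alpha:A \vdash_{\mathcal R} B$ and $C \longrightarrow_{+} (A \Rightarrow B)$ then $\lambda\alpha\,\pi$ is one of $\Gamma \vdash_{\mathcal R} C$; ($\Rightarrow$-elim) if $\pi_1$ is one of $\Gamma\vdash_{\mathcal R} C$ with $C \longrightarrow_{ - } (A \Rightarrow B)$ and $\pi_2$ one of $\Gamma \vdash_{\mathcal R} A$, then $(\pi_1\,\pi_2)$ is one of $\Gamma \vdash_{\mathcal R} B$; ($\wedge$-intro) if $\pi_1$ is one of $\Gamma \vdash_{\mathcal R} A$, $\pi_2$ one of $\Gamma\vdash_{\mathcal R} B$ and $C \longrightarrow_{+} (A\wedge B)$, then $\langle\pi_1,\pi_2\rangle$ is one of $\Gamma \vdash_{\mathcal R} C$; ($\wedge$-elim) if $\pi$ is one of $\Gamma \vdash_{\mathcal R} C$ and $C \longrightarrow_{ - } (A \wedge B)$ then $\mathit{fst}(\pi)$ is one of $\Gamma\vdash_{\mathcal R} A$ and $\mathit{snd}(\pi)$ one of $\Gamma \vdash_{\mathcal R} B$; ($\vee$-intro) if $\pi$ is one of $\Gamma\vdash_{\mathcal R} A$ (resp. $\Gamma \vdash_{\mathcal R} B$) and $C \longrightarrow_{+} (A \vee B)$ then $i(\pi)$ (resp. $j(\pi)$) is one of $\Gamma \vdash_{\mathcal R} C$; ($\vee$-elim) if $\pi_1$ is one of $\Gamma\vdash_{\mathcal R} D$ with $D \longrightarrow_{ - } (A\vee B)$, $\pi_2$ one of $\Gamma,\alpha:A \vdash_{\mathcal R} C$ and $\pi_3$ one of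 $\Gamma,\beta:B\vdash_{\mathcal R} C$, then $\delta(\pi_1,\alpha\pi_2,\beta\pi_3)$ is one of $\Gamma \vdash_{\mathcal R} C$; ($\bot$-elim) if $\pi$ is one of $\Gamma \vdash_{\mathcal R} B$ with $B \longrightarrow_{ - } \bot$ then $\delta_\bot(\pi)$ is one of $\Gamma \vdash_{\mathcal R} A$ for every $A$. Proof reduction: $\triangleright^1$ is the closure under all term contexts (including under binders) of the rules $(\lambda\alpha\,\pi_1\;\pi_2) \triangleright [\pi_2/\alpha]\pi_1$, $\mathit{fst}(\langle\pi_1,\pi_2\rangle) \triangleright \pi_1$, $\mathit{snd}(\langle\pi_1,\pi_2\rangle)\triangleright \pi_2$, $\delta(i(\pi_1),\alpha\pi_2,\beta\pi_3)\triangleright[\pi_1/\alpha]\pi_2$, $\delta(j(\pi_1),\alpha\pi_2,\beta\pi_3)\triangleright[\pi_1/\beta]\pi_3$, where $[\cdot/\cdot]$ is capture-avoiding substitution; $\triangleright$ is the reflexive-transitive closure of $\triangleright^1$. -}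

module Defs where

open import Data.Nat using (ℕ; zero; suc)
open import Data.Fin using (Fin; zero; suc)
open import Data.Vec using (Vec; _∷_; lookup)
open import Data.Product using (∃; _×_)
open import Relation.Binary.Construct.Closure.ReflexiveTransitive using (Star)

module _ (Atom : Set) where

  infixr 5 _⇒_
  infixr 6 _∨_
  infixr 7 _∧_

  data Form : Set where
    atom : Atom → Form
    ⊥'   : Form
    _⇒_  : Form → Form → Form
    _∧_  : Form → Form → Form
    _∨_  : Form → Form → Form

  ¬' : Form → Form
  ¬' A = A ⇒ ⊥'

  record PRS : Set₁ where
    field
      R₋ : Atom → Form → Set
      R₊ : Atom → Form → Set

  module Rewriting (ℛ : PRS) where
    open PRS ℛ

    infix 4 _⟶₋¹_ _⟶₊¹_ _⟶₋_ _⟶₊_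

    mutual
      data _⟶₋¹_ : Form → Form → Set where
        rule : ∀ {P A} → R₋ P A → atom P ⟶₋¹ A
        ⇒l   : ∀ {A A' B} → A ⟶₊¹ A' → (A ⇒ B) ⟶₋¹ (A' ⇒ B)
        ⇒r   : ∀ {A B B'} → B ⟶₋¹ B' → (A ⇒ B) ⟶₋¹ (A ⇒ B')
        ∧l   : ∀ {A A' B} → A ⟶₋¹ A' → (A ∧ B) ⟶₋¹ (A' ∧ B)
        ∧r   : ∀ {A B B'} → B ⟶₋¹ B' → (A ∧ B) ⟶₋¹ (A ∧ B')
        ∨l   : ∀ {A A' B} → A ⟶₋¹ A' → (A ∨ B) ⟶₋¹ (A' ∨ B)
        ∨r   : ∀ {A B B'} → B ⟶₋¹ B' → (A ∨ B) ⟶₋¹ (A ∨ B')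

      data _⟶₊¹_ : Form → Form → Set where
        rule : ∀ {P A} → R₊ P A → atom P ⟶₊¹ A
        ⇒l   : ∀ {A A' B} → A ⟶₋¹ A' → (A ⇒ B) ⟶₊¹ (A' ⇒ B)
        ⇒r   : ∀ {A B B'} → B ⟶₊¹ B' → (A ⇒ B) ⟶₊¹ (A ⇒ B')
        ∧l   : ∀ {A A' B} → A ⟶₊¹ A' → (A ∧ B) ⟶₊¹ (A' ∧ B)
        ∧r   : ∀ {A B B'} → B ⟶₊¹ B' → (A ∧ B) ⟶₊¹ (A ∧ B')
        ∨l   : ∀ {A A' B} → A ⟶₊¹ A' → (A ∨ B) ⟶₊¹ (A' ∨ B)
        ∨r   : ∀ {A B B'} → B ⟶₊¹ B' → (A ∨ B) ⟶₊¹ (A ∨ B')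

    _⟶₋_ : Form → Form → Set
    _⟶₋_ = Star _⟶₋¹_

    _⟶₊_ : Form → Form → Set
    _⟶₊_ = Star _⟶₊¹_

    Commute : Set
    Commute = ∀ {A B C} → B ⟶₋ A → B ⟶₊ C → ∃ λ D → (A ⟶₊ D) × (C ⟶₋ D)

-- Proof-terms, with proof variables as (well-scoped) de Bruijn indices.
-- Term n : proof-terms with at most n free proof variables.

data Term (n : ℕ) : Set where
  var  : Fin n → Term n
  lam  : Term (suc n) → Term n
  app  : Term n → Term n → Term n
  pair : Term n → Term n → Term n
  fst  : Term n → Term n
  snd  : Term n → Term n
  inl  : Term n → Term n
  inr  : Term n → Term n
  case : Term n → Term (suc n) → Term (suc n) → Term n
  abort : Term n → Term n

extR : ∀ {n m} → (Fin n → Fin m) → Fin (suc n) → Fin (suc m)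
extR ρ zero    = zero
extR ρ (suc x) = suc (ρ x)

rename : ∀ {n m} → (Fin n → Fin m) → Term n → Term m
rename ρ (var x)      = var (ρ x)
rename ρ (lam t)      = lam (rename (extR ρ) t)
rename ρ (app t u)    = app (rename ρ t) (rename ρ u)
rename ρ (pair t u)   = pair (rename ρ t) (rename ρ u)
rename ρ (fst t)      = fst (rename ρ t)
rename ρ (snd t)      = snd (rename ρ t)
rename ρ (inl t)      = inl (rename ρ t)
rename ρ (inr t)      = inr (rename ρ t)
rename ρ (case t u v) = case (rename ρ t) (rename (extR ρ) u) (rename (extR ρ) v)
rename ρ (abort t)    = abort (rename ρ t)

extS : ∀ {n m} → (Fin n → Term m) → Fin (suc n) → Term (suc m)
extS σ zero    = var zero
extS σ (suc x) = rename suc (σ x)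

subst : ∀ {n m} → (Fin n → Term m) → Term n → Term m
subst σ (var x)      = σ x
subst σ (lam t)      = lam (subst (extS σ) t)
subst σ (app t u)    = app (subst σ t) (subst σ u)
subst σ (pair t u)   = pair (subst σ t) (subst σ u)
subst σ (fst t)      = fst (subst σ t)
subst σ (snd t)      = snd (subst σ t)
subst σ (inl t)      = inl (subst σ t)
subst σ (inr t)      = inr (subst σ t)
subst σ (case t u v) = case (subst σ t) (subst (extS σ) u) (subst (extS σ) v)
subst σ (abort t)    = abort (subst σ t)

sub0 : ∀ {n′} → Term n′ → Term (suc n′) → Term n′
sub0 {n′} u t = subst σ t
  where
    σ : Fin (suc n′) → Term n′
    σ zero    = u
    σ (suc x) = var x

infix 4 _▷¹_ _▷_

data _▷¹_ {n : ℕ} : Term n → Term n → Set where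
  β⇒   : ∀ {t u} → app (lam t) u ▷¹ sub0 u t
  β∧₁  : ∀ {t u} → fst (pair t u) ▷¹ t
  β∧₂  : ∀ {t u} → snd (pair t u) ▷¹ u
  β∨₁  : ∀ {t u v} → case (inl t) u v ▷¹ sub0 t u
  β∨₂  : ∀ {t u v} → case (inr t) u v ▷¹ sub0 t v
  ξlam   : ∀ {t t'} → t ▷¹ t' → lam t ▷¹ lam t'
  ξappl  : ∀ {t t' u} → t ▷¹ t' → app t u ▷¹ app t' u
  ξappr  : ∀ {t u u'} → u ▷¹ u' → app t u ▷¹ app t u'
  ξpairl : ∀ {t t' u} → t ▷¹ t' → pair t u ▷¹ pair t' u
  ξpairr : ∀ {t u u'} → u ▷¹ u' → pair t u ▷¹ pair t u'
  ξfst   : ∀ {t t'} → t ▷¹ t' → fst t ▷¹ fst t'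
  ξsnd   : ∀ {t t'} → t ▷¹ t' → snd t ▷¹ snd t'
  ξinl   : ∀ {t t'} → t ▷¹ t' → inl t ▷¹ inl t'
  ξinr   : ∀ {t t'} → t ▷¹ t' → inr t ▷¹ inr t'
  ξcase₁ : ∀ {t t' u v} → t ▷¹ t' → case t u v ▷¹ case t' u v
  ξcase₂ : ∀ {t u u' v} → u ▷¹ u' → case t u v ▷¹ case t u' v
  ξcase₃ : ∀ {t u v v'} → v ▷¹ v' → case t u v ▷¹ case t u v'
  ξabort : ∀ {t t'} → t ▷¹ t' → abort t ▷¹ abort t'

_▷_ : ∀ {n} → Term n → Term n → Set
_▷_ = Star _▷¹_

module Typing (Atom : Set) (ℛ : PRS Atom) where
  open Rewriting Atom ℛ

  infix 3 _⊢_∶_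

  data _⊢_∶_ {n : ℕ} (Γ : Vec (Form Atom) n) : Term n → Form Atom → Set where
    ax    : ∀ {x A C} → lookup Γ x ⟶₋ C → A ⟶₊ C → Γ ⊢ var x ∶ A
    ⇒I    : ∀ {t A B C} → (A ∷ Γ) ⊢ t ∶ B → C ⟶₊ (A ⇒ B) → Γ ⊢ lam t ∶ C
    ⇒E    : ∀ {t u A B C} → Γ ⊢ t ∶ C → C ⟶₋ (A ⇒ B) → Γ ⊢ u ∶ A → Γ ⊢ app t u ∶ B
    ∧I    : ∀ {t u A B C} → Γ ⊢ t ∶ A → Γ ⊢ u ∶ B → C ⟶₊ (A ∧ B) → Γ ⊢ pair t u ∶ C
    ∧E₁   : ∀ {t A B C} → Γ ⊢ t ∶ C → C ⟶₋ (A ∧ B) → Γ ⊢ fst t ∶ A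
    ∧E₂   : ∀ {t A B C} → Γ ⊢ t ∶ C → C ⟶₋ (A ∧ B) → Γ ⊢ snd t ∶ B
    ∨I₁   : ∀ {t A B C} → Γ ⊢ t ∶ A → C ⟶₊ (A ∨ B) → Γ ⊢ inl t ∶ C
    ∨I₂   : ∀ {t A B C} → Γ ⊢ t ∶ B → C ⟶₊ (A ∨ B) → Γ ⊢ inr t ∶ C
    ∨E    : ∀ {t u v A B C D} → Γ ⊢ t ∶ D → D ⟶₋ (A ∨ B) →
            (A ∷ Γ) ⊢ u ∶ C → (B ∷ Γ) ⊢ v ∶ C → Γ ⊢ case t u v ∶ C
    ⊥E    : ∀ {t A B} → Γ ⊢ t ∶ B → B ⟶₋ ⊥' → Γ ⊢ abort t ∶ A

-- Write A ≼ B when A ⟶₋ C ⟵₊ B for some C: a proof of A may be used as a proof of B,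
-- which is exactly what the axiom rule allows. Commutation of ⟶₋ and ⟶₊ makes ≼
-- transitive, and then every typing judgement is monotone in ≼ (covariantly in the
-- conclusion, contravariantly in the context). A redex is an introduction of some C
-- with C ⟶₊ A ∘ B followed by an elimination with C ⟶₋ A' ∘ B'; commutation joins
-- these two reducts, so the components of A ∘ B and A' ∘ B' are related by ≼, and the
-- contractum is typed by monotonicity and the substitution lemma.
module Submission where

open import Defs
open import Data.Fin using (Fin; zero; suc)
open import Data.Vec using (Vec; _∷_; lookup)
open import Data.Product using (∃; _×_; _,_)
open import Relation.Binary.PropositionalEquality as ≡ using (_≡_; refl)
open import Relation.Binary.Construct.Closure.ReflexiveTransitive
  using (ε; _◅_; _◅◅_; gmap)
open import Data.Vec.Relation.Binary.Pointwise.Inductive as Pointwise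
  using (Pointwise; _∷_)

module Modulo (Atom : Set) (ℛ : PRS Atom) where
  open Rewriting Atom ℛ

  F : Set
  F = Form Atom

  -- Rules only rewrite atoms, so every reduct of A ∙ B is some A' ∙ B' reached componentwise.
  data Image₂ (_∙_ : F → F → F) (R S : F → F → Set) (A B : F) : F → Set where
    _,_ : ∀ {A' B'} → R A A' → S B B' → Image₂ _∙_ R S A B (A' ∙ B')

  ⇒-⟶₋-inv : ∀ {A B G} → A ⇒ B ⟶₋ G → Image₂ _⇒_ _⟶₊_ _⟶₋_ A B G
  ⇒-⟶₋-inv ε = ε , ε
  ⇒-⟶₋-inv (⇒l s ◅ r) with ⇒-⟶₋-inv r
  ... | a , b = s ◅ a , b
  ⇒-⟶₋-inv (⇒r s ◅ r) with ⇒-⟶₋-inv r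
  ... | a , b = a , s ◅ b

  ⇒-⟶₊-inv : ∀ {A B G} → A ⇒ B ⟶₊ G → Image₂ _⇒_ _⟶₋_ _⟶₊_ A B G
  ⇒-⟶₊-inv ε = ε , ε
  ⇒-⟶₊-inv (⇒l s ◅ r) with ⇒-⟶₊-inv r
  ... | a , b = s ◅ a , b
  ⇒-⟶₊-inv (⇒r s ◅ r) with ⇒-⟶₊-inv r
  ... | a , b = a , s ◅ b

  ∧-⟶₋-inv : ∀ {A B G} → A ∧ B ⟶₋ G → Image₂ _∧_ _⟶₋_ _⟶₋_ A B G
  ∧-⟶₋-inv ε = ε , ε
  ∧-⟶₋-inv (∧l s ◅ r) with ∧-⟶₋-inv r
  ... | a , b = s ◅ a , b
  ∧-⟶₋-inv (∧r s ◅ r) with ∧-⟶₋-inv r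
  ... | a , b = a , s ◅ b

  ∧-⟶₊-inv : ∀ {A B G} → A ∧ B ⟶₊ G → Image₂ _∧_ _⟶₊_ _⟶₊_ A B G
  ∧-⟶₊-inv ε = ε , ε
  ∧-⟶₊-inv (∧l s ◅ r) with ∧-⟶₊-inv r
  ... | a , b = s ◅ a , b
  ∧-⟶₊-inv (∧r s ◅ r) with ∧-⟶₊-inv r
  ... | a , b = a , s ◅ b

  ∨-⟶₋-inv : ∀ {A B G} → A ∨ B ⟶₋ G → Image₂ _∨_ _⟶₋_ _⟶₋_ A B G
  ∨-⟶₋-inv ε = ε , ε
  ∨-⟶₋-inv (∨l s ◅ r) with ∨-⟶₋-inv r
  ... | a , b = s ◅ a , b
  ∨-⟶₋-inv (∨r s ◅ r) with ∨-⟶₋-inv r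
  ... | a , b = a , s ◅ b

  ∨-⟶₊-inv : ∀ {A B G} → A ∨ B ⟶₊ G → Image₂ _∨_ _⟶₊_ _⟶₊_ A B G
  ∨-⟶₊-inv ε = ε , ε
  ∨-⟶₊-inv (∨l s ◅ r) with ∨-⟶₊-inv r
  ... | a , b = s ◅ a , b
  ∨-⟶₊-inv (∨r s ◅ r) with ∨-⟶₊-inv r
  ... | a , b = a , s ◅ b

  infix 4 _≼_

  _≼_ : F → F → Set
  A ≼ B = ∃ λ C → (A ⟶₋ C) × (B ⟶₊ C)

  ≼-refl : ∀ {A} → A ≼ A
  ≼-refl = _ , ε , ε

  ⟶₋⇒≼ : ∀ {A B} → A ⟶₋ B → A ≼ B
  ⟶₋⇒≼ r = _ , r , ε

  ⟵₊⇒≼ : ∀ {A B} → B ⟶₊ A → A ≼ B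
  ⟵₊⇒≼ r = _ , ε , r

  ⇒-≼-inv : ∀ {A B A' B'} → A ⇒ B ≼ A' ⇒ B' → A' ≼ A × B ≼ B'
  ⇒-≼-inv (_ , r , r') with ⇒-⟶₋-inv r | ⇒-⟶₊-inv r'
  ... | a , b | a' , b' = (_ , a' , a) , (_ , b , b')

  ∧-≼-inv : ∀ {A B A' B'} → A ∧ B ≼ A' ∧ B' → A ≼ A' × B ≼ B'
  ∧-≼-inv (_ , r , r') with ∧-⟶₋-inv r | ∧-⟶₊-inv r'
  ... | a , b | a' , b' = (_ , a , a') , (_ , b , b')

  ∨-≼-inv : ∀ {A B A' B'} → A ∨ B ≼ A' ∨ B' → A ≼ A' × B ≼ B'
  ∨-≼-inv (_ , r , r') with ∨-⟶₋-inv r | ∨-⟶₊-inv r'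
  ... | a , b | a' , b' = (_ , a , a') , (_ , b , b')

  ≼-⇒ʳ : ∀ {A B B'} → B ≼ B' → A ⇒ B ≼ A ⇒ B'
  ≼-⇒ʳ {A} (_ , b , b') = _ , gmap (A ⇒_) ⇒r b , gmap (A ⇒_) ⇒r b'

  ≼-∧ˡ : ∀ {A A' B} → A ≼ A' → A ∧ B ≼ A' ∧ B
  ≼-∧ˡ {B = B} (_ , a , a') = _ , gmap (_∧ B) ∧l a , gmap (_∧ B) ∧l a'

  ≼-∧ʳ : ∀ {A B B'} → B ≼ B' → A ∧ B ≼ A ∧ B'
  ≼-∧ʳ {A} (_ , b , b') = _ , gmap (A ∧_) ∧r b , gmap (A ∧_) ∧r b'

  open Typing Atom ℛ

  Renaming : ∀ {n m} → (Fin n → Fin m) → Vec F m → Vec F n → Set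
  Renaming ρ Δ Γ = ∀ x → lookup Δ (ρ x) ≡ lookup Γ x

  Renaming-ext : ∀ {n m} {ρ : Fin n → Fin m} {Δ Γ A} →
                 Renaming ρ Δ Γ → Renaming (extR ρ) (A ∷ Δ) (A ∷ Γ)
  Renaming-ext r zero    = refl
  Renaming-ext r (suc x) = r x

  ⊢-rename : ∀ {n m} {ρ : Fin n → Fin m} {Δ Γ t A} →
             Renaming ρ Δ Γ → Γ ⊢ t ∶ A → Δ ⊢ rename ρ t ∶ A
  ⊢-rename r (ax {x} a b)    = ax (≡.subst (_⟶₋ _) (≡.sym (r x)) a) b
  ⊢-rename r (⇒I dt p)       = ⇒I (⊢-rename (Renaming-ext r) dt) p
  ⊢-rename r (⇒E dt q du)    = ⇒E (⊢-rename r dt) q (⊢-rename r du)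
  ⊢-rename r (∧I dt du p)    = ∧I (⊢-rename r dt) (⊢-rename r du) p
  ⊢-rename r (∧E₁ dt q)      = ∧E₁ (⊢-rename r dt) q
  ⊢-rename r (∧E₂ dt q)      = ∧E₂ (⊢-rename r dt) q
  ⊢-rename r (∨I₁ dt p)      = ∨I₁ (⊢-rename r dt) p
  ⊢-rename r (∨I₂ dt p)      = ∨I₂ (⊢-rename r dt) p
  ⊢-rename r (∨E dt q du dv) =
    ∨E (⊢-rename r dt) q (⊢-rename (Renaming-ext r) du) (⊢-rename (Renaming-ext r) dv)
  ⊢-rename r (⊥E dt q)       = ⊥E (⊢-rename r dt) q

  ⊢-weaken : ∀ {n} {Γ : Vec F n} {t A B} → Γ ⊢ t ∶ A → (B ∷ Γ) ⊢ rename suc t ∶ A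
  ⊢-weaken = ⊢-rename (λ _ → refl)

  module Commuting (commute : Commute) where

    ≼-trans : ∀ {A B C} → A ≼ B → B ≼ C → A ≼ C
    ≼-trans (_ , a , b) (_ , b' , c) with commute b' b
    ... | _ , d , e = _ , a ◅◅ e , c ◅◅ d

    ≼-⟶₊ : ∀ {A B X} → A ≼ B → A ⟶₊ X → ∃ λ G → (B ⟶₊ G) × (X ⟶₋ G)
    ≼-⟶₊ (_ , a , b) p with commute a p
    ... | _ , g , x = _ , b ◅◅ g , x

    peak⇒≼ : ∀ {A X Y} → A ⟶₋ X → A ⟶₊ Y → Y ≼ X
    peak⇒≼ q p with commute q p
    ... | _ , x , y = _ , y , x

    ax≼ : ∀ {n} {Γ : Vec F n} {x A} → lookup Γ x ≼ A → Γ ⊢ var x ∶ A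
    ax≼ (_ , a , b) = ax a b

    ⊢-mono : ∀ {n} {Γ' Γ : Vec F n} {t A B} →
             Pointwise _≼_ Γ' Γ → Γ ⊢ t ∶ A → A ≼ B → Γ' ⊢ t ∶ B
    ⊢-mono ρ (ax {x} a b) h = ax≼ (≼-trans (Pointwise.lookup ρ x) (≼-trans (_ , a , b) h))
    ⊢-mono ρ (⇒I dt p) h with ≼-⟶₊ h p
    ... | _ , e , r with ⇒-⟶₋-inv r
    ... | a , b = ⇒I (⊢-mono (⟵₊⇒≼ a ∷ ρ) dt (⟶₋⇒≼ b)) e
    ⊢-mono ρ (⇒E dt q du) h =
      ⇒E (⊢-mono ρ dt (≼-trans (⟶₋⇒≼ q) (≼-⇒ʳ h))) ε (⊢-mono ρ du ≼-refl)
    ⊢-mono ρ (∧I dt du p) h with ≼-⟶₊ h p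
    ... | _ , e , r with ∧-⟶₋-inv r
    ... | a , b = ∧I (⊢-mono ρ dt (⟶₋⇒≼ a)) (⊢-mono ρ du (⟶₋⇒≼ b)) e
    ⊢-mono ρ (∧E₁ dt q) h = ∧E₁ (⊢-mono ρ dt (≼-trans (⟶₋⇒≼ q) (≼-∧ˡ h))) ε
    ⊢-mono ρ (∧E₂ dt q) h = ∧E₂ (⊢-mono ρ dt (≼-trans (⟶₋⇒≼ q) (≼-∧ʳ h))) ε
    ⊢-mono ρ (∨I₁ dt p) h with ≼-⟶₊ h p
    ... | _ , e , r with ∨-⟶₋-inv r
    ... | a , _ = ∨I₁ (⊢-mono ρ dt (⟶₋⇒≼ a)) e
    ⊢-mono ρ (∨I₂ dt p) h with ≼-⟶₊ h p
    ... | _ , e , r with ∨-⟶₋-inv r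
    ... | _ , b = ∨I₂ (⊢-mono ρ dt (⟶₋⇒≼ b)) e
    ⊢-mono ρ (∨E dt q du dv) h =
      ∨E (⊢-mono ρ dt ≼-refl) q (⊢-mono (≼-refl ∷ ρ) du h) (⊢-mono (≼-refl ∷ ρ) dv h)
    ⊢-mono ρ (⊥E dt q) h = ⊥E (⊢-mono ρ dt ≼-refl) q

    ⊢-conv : ∀ {n} {Γ : Vec F n} {t A B} → Γ ⊢ t ∶ A → A ≼ B → Γ ⊢ t ∶ B
    ⊢-conv = ⊢-mono (Pointwise.refl ≼-refl)

    Substitution : ∀ {n m} → (Fin n → Term m) → Vec F m → Vec F n → Set
    Substitution σ Δ Γ = ∀ x → Δ ⊢ σ x ∶ lookup Γ x

    Substitution-ext : ∀ {n m} {σ : Fin n → Term m} {Δ Γ A} →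
                       Substitution σ Δ Γ → Substitution (extS σ) (A ∷ Δ) (A ∷ Γ)
    Substitution-ext s zero    = ax ε ε
    Substitution-ext s (suc x) = ⊢-weaken (s x)

    ⊢-subst : ∀ {n m} {σ : Fin n → Term m} {Δ Γ t A} →
              Substitution σ Δ Γ → Γ ⊢ t ∶ A → Δ ⊢ subst σ t ∶ A
    ⊢-subst s (ax {x} a b)    = ⊢-conv (s x) (_ , a , b)
    ⊢-subst s (⇒I dt p)       = ⇒I (⊢-subst (Substitution-ext s) dt) p
    ⊢-subst s (⇒E dt q du)    = ⇒E (⊢-subst s dt) q (⊢-subst s du)
    ⊢-subst s (∧I dt du p)    = ∧I (⊢-subst s dt) (⊢-subst s du) p
    ⊢-subst s (∧E₁ dt q)      = ∧E₁ (⊢-subst s dt) q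
    ⊢-subst s (∧E₂ dt q)      = ∧E₂ (⊢-subst s dt) q
    ⊢-subst s (∨I₁ dt p)      = ∨I₁ (⊢-subst s dt) p
    ⊢-subst s (∨I₂ dt p)      = ∨I₂ (⊢-subst s dt) p
    ⊢-subst s (∨E dt q du dv) =
      ∨E (⊢-subst s dt) q (⊢-subst (Substitution-ext s) du) (⊢-subst (Substitution-ext s) dv)
    ⊢-subst s (⊥E dt q)       = ⊥E (⊢-subst s dt) q

    ⊢-sub0 : ∀ {n} {Γ : Vec F n} {u t A B} →
             Γ ⊢ u ∶ A → (A ∷ Γ) ⊢ t ∶ B → Γ ⊢ sub0 u t ∶ B
    ⊢-sub0 du = ⊢-subst λ { zero → du ; (suc x) → ax ε ε }

    ⊢-▷¹ : ∀ {n} {Γ : Vec F n} {t t' A} → Γ ⊢ t ∶ A → t ▷¹ t' → Γ ⊢ t' ∶ A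
    ⊢-▷¹ (⇒E (⇒I dt p) q du) β⇒ with ⇒-≼-inv (peak⇒≼ q p)
    ... | a , b = ⊢-sub0 (⊢-conv du a) (⊢-conv dt b)
    ⊢-▷¹ (∧E₁ (∧I dt du p) q) β∧₁ with ∧-≼-inv (peak⇒≼ q p)
    ... | a , _ = ⊢-conv dt a
    ⊢-▷¹ (∧E₂ (∧I dt du p) q) β∧₂ with ∧-≼-inv (peak⇒≼ q p)
    ... | _ , b = ⊢-conv du b
    ⊢-▷¹ (∨E (∨I₁ dt p) q du dv) β∨₁ with ∨-≼-inv (peak⇒≼ q p)
    ... | a , _ = ⊢-sub0 (⊢-conv dt a) du
    ⊢-▷¹ (∨E (∨I₂ dt p) q du dv) β∨₂ with ∨-≼-inv (peak⇒≼ q p)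
    ... | _ , b = ⊢-sub0 (⊢-conv dt b) dv
    ⊢-▷¹ (⇒I dt p)       (ξlam r)   = ⇒I (⊢-▷¹ dt r) p
    ⊢-▷¹ (⇒E dt q du)    (ξappl r)  = ⇒E (⊢-▷¹ dt r) q du
    ⊢-▷¹ (⇒E dt q du)    (ξappr r)  = ⇒E dt q (⊢-▷¹ du r)
    ⊢-▷¹ (∧I dt du p)    (ξpairl r) = ∧I (⊢-▷¹ dt r) du p
    ⊢-▷¹ (∧I dt du p)    (ξpairr r) = ∧I dt (⊢-▷¹ du r) p
    ⊢-▷¹ (∧E₁ dt q)      (ξfst r)   = ∧E₁ (⊢-▷¹ dt r) q
    ⊢-▷¹ (∧E₂ dt q)      (ξsnd r)   = ∧E₂ (⊢-▷¹ dt r) q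
    ⊢-▷¹ (∨I₁ dt p)      (ξinl r)   = ∨I₁ (⊢-▷¹ dt r) p
    ⊢-▷¹ (∨I₂ dt p)      (ξinr r)   = ∨I₂ (⊢-▷¹ dt r) p
    ⊢-▷¹ (∨E dt q du dv) (ξcase₁ r) = ∨E (⊢-▷¹ dt r) q du dv
    ⊢-▷¹ (∨E dt q du dv) (ξcase₂ r) = ∨E dt q (⊢-▷¹ du r) dv
    ⊢-▷¹ (∨E dt q du dv) (ξcase₃ r) = ∨E dt q du (⊢-▷¹ dv r)
    ⊢-▷¹ (⊥E dt q)       (ξabort r) = ⊥E (⊢-▷¹ dt r) q

    ⊢-▷ : ∀ {n} {Γ : Vec F n} {t t' A} → Γ ⊢ t ∶ A → t ▷ t' → Γ ⊢ t' ∶ A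
    ⊢-▷ d ε        = d
    ⊢-▷ d (r ◅ rs) = ⊢-▷ (⊢-▷¹ d r) rs

proposition3 : (Atom : Set) (ℛ : PRS Atom) → Rewriting.Commute Atom ℛ →
    ∀ {n} (Γ : Vec (Form Atom) n) (π π' : Term n) (A : Form Atom) →
    Typing._⊢_∶_ Atom ℛ Γ π A → π ▷ π' → Typing._⊢_∶_ Atom ℛ Γ π' A
proposition3 Atom ℛ commute Γ π π' A = Modulo.Commuting.⊢-▷ Atom ℛ commute
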